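{- Let $\Gamma\subseteq\Sigma$ be alphabets, $H$ a set of hypotheses over $\Sigma$ and $H'$ a set of hypotheses over $\Gamma$. If $\mathsf{KA}_{H'}$ is complete and decidable, and $H$ reduces to $H'$ via a computable map $r$, then $\mathsf{KA}_H$ is decidable.
   Context: Regular expressions $T(X)$ over an alphabet $X$: $e,f::=e+f\mid e\cdot f\mid e^*\mid 0\mid 1\mid a$ ($a\in X$), with usual language $\llbracket e\rrbracket$. Kleene algebra axioms: idempotent semiring axioms plus $1+xx^*\le x^*$, $x+yz\le z\Rightarrow y^*x\le z$, $x+yz\le y\Rightarrow xz^*\le y$. A hypothesis is a pair of regular expressions $e\le f$. $\mathsf{KA}_H\vdash e=f$ means derivable in equational logic from all instances of the Kleene algebra axioms and the hypotheses in $H$, letters being constants (no substitution rule); $\mathsf{KA}_H$ is decidable if the relation $\{(e,f)\mid\mathsf{KA}_H\vdash e=f\}$ is decidable; $\mathsf{KA}_H\vdash H'$ means all inequations of $H'$ are derivable. The $H$-closure $H^\star(L)$ is the smallest language containing $L$ such that for all $e\le f\in H$ and words $u,v$, $u\llbracket f\rrbracket v\subseteq H^\star(L)$ implies $u\llbracket e\rrbracket v\subseteq H^\star(L)$. $\mathsf{KA}_H$ is complete if $H^\star(\llbracket e\rrbracket)=H^\star(\llbracket f\rrbracket)$ implies $\mathsf{KA}_H\vdash e=f$. $H$ reduces to $H'$ via $r:T(\Sigma)\to T(\Gamma)$ if $\mathsf{KA}_H\vdash H'$ and for all $e\in T(\Sigma)$, $\mathsf{KA}_H\vdash e=r(e)$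 and $H^\star(\llbracket e\rrbracket)\cap\Gamma^*\subseteq H'^\star(\llbracket r(e)\rrbracket)$. -}

module Defs where

open import Data.List using (List; []; _∷_; _++_; map)
open import Data.Product using (_×_; Σ; ∃; _,_)
open import Relation.Binary.PropositionalEquality using (_≡_)
open import Relation.Nullary using (Dec)
open import Function.Definitions using (Injective)

data T (X : Set) : Set where
  _⊕_ : T X → T X → T X
  _⊙_ : T X → T X → T X
  _⋆  : T X → T X
  𝟘   : T X
  𝟙   : T X
  lit : X → T X

infixl 6 _⊕_
infixl 7 _⊙_

-- functorial action (used to view T(Γ) inside T(Σ) for Γ ⊆ Σ)
mapT : {X Y : Set} → (X → Y) → T X → T Y
mapT g (e ⊕ f) = mapT g e ⊕ mapT g f
mapT g (e ⊙ f) = mapT g e ⊙ mapT g f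
mapT g (e ⋆)   = mapT g e ⋆
mapT g 𝟘       = 𝟘
mapT g 𝟙       = 𝟙
mapT g (lit a) = lit (g a)

Lang : Set → Set₁
Lang X = List X → Set

data ⟦_⟧ {X : Set} : T X → Lang X where
  inl  : ∀ {e f w} → ⟦ e ⟧ w → ⟦ e ⊕ f ⟧ w
  inr  : ∀ {e f w} → ⟦ f ⟧ w → ⟦ e ⊕ f ⟧ w
  cat  : ∀ {e f u v w} → ⟦ e ⟧ u → ⟦ f ⟧ v → w ≡ u ++ v → ⟦ e ⊙ f ⟧ w
  nil  : ∀ {e} → ⟦ e ⋆ ⟧ []
  more : ∀ {e u v w} → ⟦ e ⟧ u → ⟦ e ⋆ ⟧ v → w ≡ u ++ v → ⟦ e ⋆ ⟧ w
  one  : ⟦ 𝟙 ⟧ []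
  sym  : ∀ {a} → ⟦ lit a ⟧ (a ∷ [])

-- A set of hypotheses: a (possibly infinite) set of pairs (e , f), read e ≤ f
Hyps : Set → Set₁
Hyps X = T X → T X → Set

-- Derivability in equational logic: KA_H ⊢ e ≈ f
-- (all instances of the KA axioms, hypotheses of H, letters are constants)
infix 4 _⊢_≈_ _⊢_≤_

data _⊢_≈_ {X : Set} (H : Hyps X) : T X → T X → Set

_⊢_≤_ : {X : Set} → Hyps X → T X → T X → Set
H ⊢ e ≤ f = H ⊢ e ⊕ f ≈ f

data _⊢_≈_ {X} H where
  refl  : ∀ {e} → H ⊢ e ≈ e
  sym   : ∀ {e f} → H ⊢ e ≈ f → H ⊢ f ≈ e
  trans : ∀ {e f g} → H ⊢ e ≈ f → H ⊢ f ≈ g → H ⊢ e ≈ g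
  ⊕-cong : ∀ {e e' f f'} → H ⊢ e ≈ e' → H ⊢ f ≈ f' → H ⊢ e ⊕ f ≈ e' ⊕ f'
  ⊙-cong : ∀ {e e' f f'} → H ⊢ e ≈ e' → H ⊢ f ≈ f' → H ⊢ e ⊙ f ≈ e' ⊙ f'
  ⋆-cong : ∀ {e e'} → H ⊢ e ≈ e' → H ⊢ e ⋆ ≈ e' ⋆
  ⊕-assoc : ∀ {e f g} → H ⊢ (e ⊕ f) ⊕ g ≈ e ⊕ (f ⊕ g)
  ⊕-comm  : ∀ {e f} → H ⊢ e ⊕ f ≈ f ⊕ e
  ⊕-idem  : ∀ {e} → H ⊢ e ⊕ e ≈ e
  ⊕-zero  : ∀ {e} → H ⊢ e ⊕ 𝟘 ≈ e
  ⊙-assoc : ∀ {e f g} → H ⊢ (e ⊙ f) ⊙ g ≈ e ⊙ (f ⊙ g)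
  ⊙-oneˡ  : ∀ {e} → H ⊢ 𝟙 ⊙ e ≈ e
  ⊙-oneʳ  : ∀ {e} → H ⊢ e ⊙ 𝟙 ≈ e
  ⊙-zeroˡ : ∀ {e} → H ⊢ 𝟘 ⊙ e ≈ 𝟘
  ⊙-zeroʳ : ∀ {e} → H ⊢ e ⊙ 𝟘 ≈ 𝟘
  distribˡ : ∀ {e f g} → H ⊢ e ⊙ (f ⊕ g) ≈ (e ⊙ f) ⊕ (e ⊙ g)
  distribʳ : ∀ {e f g} → H ⊢ (e ⊕ f) ⊙ g ≈ (e ⊙ g) ⊕ (f ⊙ g)
  ⋆-unfold : ∀ {e} → H ⊢ 𝟙 ⊕ e ⊙ (e ⋆) ≤ e ⋆
  ⋆-indˡ   : ∀ {x y z} → H ⊢ x ⊕ y ⊙ z ≤ z → H ⊢ (y ⋆) ⊙ x ≤ z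
  ⋆-indʳ   : ∀ {x y z} → H ⊢ x ⊕ y ⊙ z ≤ y → H ⊢ x ⊙ (z ⋆) ≤ y
  hyp : ∀ {e f} → H e f → H ⊢ e ≤ f

KADecidable : {X : Set} → Hyps X → Set
KADecidable H = ∀ e f → Dec (H ⊢ e ≈ f)

data Closure {X : Set} (H : Hyps X) (L : Lang X) : Lang X where
  base : ∀ {w} → L w → Closure H L w
  step : ∀ {e f} → H e f → (u v : List X) →
         (∀ x → ⟦ f ⟧ x → Closure H L (u ++ x ++ v)) →
         ∀ {w w'} → ⟦ e ⟧ w → w' ≡ u ++ w ++ v → Closure H L w'

_≐_ : {X : Set} → Lang X → Lang X → Set
L ≐ K = ∀ w → (L w → K w) × (K w → L w)

KAComplete : {X : Set} → Hyps X → Set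
KAComplete H = ∀ e f → Closure H ⟦ e ⟧ ≐ Closure H ⟦ f ⟧ → H ⊢ e ≈ f

record Reduces {Γ Σ : Set} (ι : Γ → Σ) (H : Hyps Σ) (H' : Hyps Γ)
               (r : T Σ → T Γ) : Set where
  field
    derivesH' : ∀ e f → H' e f → H ⊢ mapT ι e ≤ mapT ι f
    equiv     : ∀ e → H ⊢ e ≈ mapT ι (r e)
    closure⊆  : ∀ e (w : List Γ) → Closure H ⟦ e ⟧ (map ι w) → Closure H' ⟦ r e ⟧ w

-- A reduction makes  H ⊢ e ≈ f  equivalent to  H' ⊢ r e ≈ r f.  From right to left, push the
-- H'-derivation into Σ (H derives every hypothesis of H') and use e ≈ r e, f ≈ r f in KA_H.
-- From left to right, KA_H is sound for the closure semantics: the H'-closure of r e embeds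
-- into the H-closure of e, which equals that of f, whose Γ-words lie in the H'-closure of r f.
-- So the H'-closures of r e and r f agree and completeness of KA_H' yields the derivation.
module Submission where

open import Defs
open import Function.Definitions using (Injective)
open import Relation.Binary.PropositionalEquality using (_≡_)
import Relation.Binary.PropositionalEquality as Eq
open Eq.≡-Reasoning
open import Data.List using (List; []; _++_; map)
open import Data.List.Properties using (++-assoc; ++-identityʳ; map-++)
open import Data.Product using (_×_; ∃; _,_; proj₁; proj₂; swap)
open import Relation.Nullary.Decidable using (map′)

++-regroup : {A : Set} (u u₀ z v₀ v : List A) →
             u ++ (u₀ ++ z ++ v₀) ++ v ≡ (u ++ u₀) ++ z ++ v₀ ++ v
++-regroup u u₀ z v₀ v = begin
  u ++ (u₀ ++ z ++ v₀) ++ v  ≡⟨ Eq.cong (u ++_) (++-assoc u₀ (z ++ v₀) v) ⟩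
  u ++ u₀ ++ (z ++ v₀) ++ v  ≡⟨ Eq.cong (λ t → u ++ u₀ ++ t) (++-assoc z v₀ v) ⟩
  u ++ u₀ ++ z ++ v₀ ++ v    ≡⟨ ++-assoc u u₀ (z ++ v₀ ++ v) ⟨
  (u ++ u₀) ++ z ++ v₀ ++ v  ∎

map-++₃ : {A B : Set} (g : A → B) (u w v : List A) →
          map g (u ++ w ++ v) ≡ map g u ++ map g w ++ map g v
map-++₃ g u w v = begin
  map g (u ++ w ++ v)          ≡⟨ map-++ g u (w ++ v) ⟩
  map g u ++ map g (w ++ v)    ≡⟨ Eq.cong (map g u ++_) (map-++ g w v) ⟩
  map g u ++ map g w ++ map g v ∎

module _ {X : Set} {H : Hyps X} where

  Closure-bind : {L K : Lang X} → (∀ {w} → L w → Closure H K w) →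
                 ∀ {w} → Closure H L w → Closure H K w
  Closure-bind g (base x)             = g x
  Closure-bind g (step h u v k ew eq) = step h u v (λ x fx → Closure-bind g (k x fx)) ew eq

  Closure-map : {L K : Lang X} → (∀ {w} → L w → K w) → ∀ {w} → Closure H L w → Closure H K w
  Closure-map g = Closure-bind (λ x → base (g x))

  Closure-bindInContext : {K M : Lang X} (u v : List X) {y : List X} → Closure H K y →
                          (∀ {x} → K x → Closure H M (u ++ x ++ v)) → Closure H M (u ++ y ++ v)
  Closure-bindInContext u v (base k) g = g k
  Closure-bindInContext {M = M} u v (step h u₀ v₀ k {w₀} ew eq) g =
    step h (u ++ u₀) (v₀ ++ v)
      (λ z fz → Eq.subst (Closure H M) (++-regroup u u₀ z v₀ v) (Closure-bindInContext u v (k z fz) g))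
      ew (Eq.trans (Eq.cong (λ y → u ++ y ++ v) eq) (++-regroup u u₀ w₀ v₀ v))

  Closure-concat : {L K M : Lang X} → (∀ {a b} → L a → K b → M (a ++ b)) →
                   ∀ {a b} → Closure H L a → Closure H K b → Closure H M (a ++ b)
  Closure-concat {M = M} P {b = b} ca cb = Closure-bindInContext [] b ca λ {a} La →
    Eq.subst (Closure H M) (Eq.cong (a ++_) (++-identityʳ b))
      (Closure-bindInContext a [] cb λ {b′} Kb →
        Eq.subst (Closure H M) (Eq.cong (a ++_) (Eq.sym (++-identityʳ b′))) (base (P La Kb)))

module Soundness {X : Set} (H : Hyps X) where

  infix 4 _⊑_

  _⊑_ : T X → T X → Set
  e ⊑ f = ∀ {w} → ⟦ e ⟧ w → Closure H ⟦ f ⟧ w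

  ⊑-trans : ∀ {e f g} → e ⊑ f → f ⊑ g → e ⊑ g
  ⊑-trans p q x = Closure-bind q (p x)

  ⊑-fromLanguage : ∀ {e f} → (∀ {w} → ⟦ e ⟧ w → ⟦ f ⟧ w) → (∀ {w} → ⟦ f ⟧ w → ⟦ e ⟧ w) →
                   e ⊑ f × f ⊑ e
  ⊑-fromLanguage g h = (λ x → base (g x)) , (λ x → base (h x))

  ⊑⇒≤ : ∀ {e f} → e ⊑ f → (e ⊕ f) ⊑ f × f ⊑ (e ⊕ f)
  ⊑⇒≤ p = (λ { (inl x) → p x ; (inr x) → base x }) , (λ x → base (inr x))

  ⊕-mono-⊑ : ∀ {e e′ f f′} → e ⊑ e′ → f ⊑ f′ → e ⊕ f ⊑ e′ ⊕ f′
  ⊕-mono-⊑ p q (inl x) = Closure-map inl (p x)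
  ⊕-mono-⊑ p q (inr x) = Closure-map inr (q x)

  ⊙-mono-⊑ : ∀ {e e′ f f′} → e ⊑ e′ → f ⊑ f′ → e ⊙ f ⊑ e′ ⊙ f′
  ⊙-mono-⊑ p q (cat x y eq) =
    Eq.subst (Closure H _) (Eq.sym eq) (Closure-concat (λ a b → cat a b Eq.refl) (p x) (q y))

  ⋆-mono-⊑ : ∀ {e e′} → e ⊑ e′ → e ⋆ ⊑ e′ ⋆
  ⋆-mono-⊑ p nil            = base nil
  ⋆-mono-⊑ p (more x xs eq) =
    Eq.subst (Closure H _) (Eq.sym eq) (Closure-concat (λ a b → more a b Eq.refl) (p x) (⋆-mono-⊑ p xs))

  ⋆-indˡ-⊑ : ∀ {x y z} → x ⊕ y ⊙ z ⊑ z → (y ⋆) ⊙ x ⊑ z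
  ⋆-indˡ-⊑ {x} {y} {z} p (cat ys xb eq) = Eq.subst (Closure H ⟦ z ⟧) (Eq.sym eq) (prepend ys (p (inl xb)))
    where
    prepend : ∀ {a b} → ⟦ y ⋆ ⟧ a → Closure H ⟦ z ⟧ b → Closure H ⟦ z ⟧ (a ++ b)
    prepend nil cb = cb
    prepend {b = b} (more {u = u} {v} yu yv eq′) cb =
      Eq.subst (Closure H ⟦ z ⟧) (Eq.trans (Eq.sym (++-assoc u v b)) (Eq.cong (_++ b) (Eq.sym eq′)))
        (Closure-bind (λ yz → p (inr yz)) (Closure-concat (λ a c → cat a c Eq.refl) (base yu) (prepend yv cb)))

  ⋆-indʳ-⊑ : ∀ {x y z} → x ⊕ y ⊙ z ⊑ y → x ⊙ (z ⋆) ⊑ y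
  ⋆-indʳ-⊑ {x} {y} {z} p (cat xa zs eq) = Eq.subst (Closure H ⟦ y ⟧) (Eq.sym eq) (append (p (inl xa)) zs)
    where
    append : ∀ {a b} → Closure H ⟦ y ⟧ a → ⟦ z ⋆ ⟧ b → Closure H ⟦ y ⟧ (a ++ b)
    append {a} ca nil = Eq.subst (Closure H ⟦ y ⟧) (Eq.sym (++-identityʳ a)) ca
    append {a} ca (more {u = u} {v} zu zv eq′) =
      Eq.subst (Closure H ⟦ y ⟧) (Eq.trans (++-assoc a u v) (Eq.cong (a ++_) (Eq.sym eq′)))
        (append (Closure-bind (λ yz → p (inr yz)) (Closure-concat (λ c d → cat c d Eq.refl) ca (base zu))) zv)

  hyp-⊑ : ∀ {e f} → H e f → e ⊑ f
  hyp-⊑ {f = f} h {w} x =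
    step h [] [] (λ y fy → base (Eq.subst ⟦ f ⟧ (Eq.sym (++-identityʳ y)) fy)) x (Eq.sym (++-identityʳ w))

  mutual
    sound : ∀ {e f} → H ⊢ e ≈ f → e ⊑ f × f ⊑ e
    sound refl          = base , base
    sound (sym d)       = swap (sound d)
    sound (trans d d′)  = let (p , q) = sound d ; (p′ , q′) = sound d′ in ⊑-trans p p′ , ⊑-trans q′ q
    sound (⊕-cong d d′) = let (p , q) = sound d ; (p′ , q′) = sound d′ in ⊕-mono-⊑ p p′ , ⊕-mono-⊑ q q′
    sound (⊙-cong d d′) = let (p , q) = sound d ; (p′ , q′) = sound d′ in ⊙-mono-⊑ p p′ , ⊙-mono-⊑ q q′
    sound (⋆-cong d)    = let (p , q) = sound d in ⋆-mono-⊑ p , ⋆-mono-⊑ q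
    sound ⊕-assoc = ⊑-fromLanguage
      (λ { (inl (inl x)) → inl x ; (inl (inr x)) → inr (inl x) ; (inr x) → inr (inr x) })
      (λ { (inl x) → inl (inl x) ; (inr (inl x)) → inl (inr x) ; (inr (inr x)) → inr x })
    sound ⊕-comm  = ⊑-fromLanguage (λ { (inl x) → inr x ; (inr x) → inl x }) (λ { (inl x) → inr x ; (inr x) → inl x })
    sound ⊕-idem  = ⊑-fromLanguage (λ { (inl x) → x ; (inr x) → x }) inl
    sound ⊕-zero  = ⊑-fromLanguage (λ { (inl x) → x ; (inr ()) }) inl
    sound ⊙-assoc = ⊑-fromLanguage
      (λ { (cat (cat {u = a} {b} x y eq) z eq′) →
             cat x (cat y z Eq.refl) (Eq.trans eq′ (Eq.trans (Eq.cong (_++ _) eq) (++-assoc a b _))) })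
      (λ { (cat {u = a} x (cat {u = b} {c} y z eq) eq′) →
             cat (cat x y Eq.refl) z (Eq.trans eq′ (Eq.trans (Eq.cong (a ++_) eq) (Eq.sym (++-assoc a b c)))) })
    sound ⊙-oneˡ  = ⊑-fromLanguage (λ { (cat one x eq) → Eq.subst ⟦ _ ⟧ (Eq.sym eq) x }) (λ x → cat one x Eq.refl)
    sound ⊙-oneʳ  = ⊑-fromLanguage
      (λ { (cat {u = u} x one eq) → Eq.subst ⟦ _ ⟧ (Eq.sym (Eq.trans eq (++-identityʳ u))) x })
      (λ {w} x → cat x one (Eq.sym (++-identityʳ w)))
    sound ⊙-zeroˡ = ⊑-fromLanguage (λ { (cat () _ _) }) (λ ())
    sound ⊙-zeroʳ = ⊑-fromLanguage (λ { (cat _ () _) }) (λ ())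
    sound distribˡ = ⊑-fromLanguage
      (λ { (cat x (inl y) eq) → inl (cat x y eq) ; (cat x (inr y) eq) → inr (cat x y eq) })
      (λ { (inl (cat x y eq)) → cat x (inl y) eq ; (inr (cat x y eq)) → cat x (inr y) eq })
    sound distribʳ = ⊑-fromLanguage
      (λ { (cat (inl x) y eq) → inl (cat x y eq) ; (cat (inr x) y eq) → inr (cat x y eq) })
      (λ { (inl (cat x y eq)) → cat (inl x) y eq ; (inr (cat x y eq)) → cat (inr x) y eq })
    sound ⋆-unfold = ⊑⇒≤ (λ { (inl one) → base nil ; (inr (cat x y eq)) → base (more x y eq) })
    sound (⋆-indˡ d) = ⊑⇒≤ (⋆-indˡ-⊑ (sound-≤ d))
    sound (⋆-indʳ d) = ⊑⇒≤ (⋆-indʳ-⊑ (sound-≤ d))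
    sound (hyp h)    = ⊑⇒≤ (hyp-⊑ h)

    sound-≤ : ∀ {e f} → H ⊢ e ≤ f → e ⊑ f
    sound-≤ d x = proj₁ (sound d) (inl x)

  soundness : ∀ {e f} → H ⊢ e ≈ f → Closure H ⟦ e ⟧ ≐ Closure H ⟦ f ⟧
  soundness d w = Closure-bind (proj₁ (sound d)) , Closure-bind (proj₂ (sound d))

open Soundness using (sound-≤; soundness)

module _ {Γ Σ : Set} (ι : Γ → Σ) where

  _⊢[ι]_ : Hyps Σ → Hyps Γ → Set
  H ⊢[ι] H' = ∀ e f → H' e f → H ⊢ mapT ι e ≤ mapT ι f

  mapT-derivation : ∀ {H H' e f} → H ⊢[ι] H' → H' ⊢ e ≈ f → H ⊢ mapT ι e ≈ mapT ι f
  mapT-derivation g refl          = refl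
  mapT-derivation g (sym d)       = sym (mapT-derivation g d)
  mapT-derivation g (trans d d′)  = trans (mapT-derivation g d) (mapT-derivation g d′)
  mapT-derivation g (⊕-cong d d′) = ⊕-cong (mapT-derivation g d) (mapT-derivation g d′)
  mapT-derivation g (⊙-cong d d′) = ⊙-cong (mapT-derivation g d) (mapT-derivation g d′)
  mapT-derivation g (⋆-cong d)    = ⋆-cong (mapT-derivation g d)
  mapT-derivation g ⊕-assoc       = ⊕-assoc
  mapT-derivation g ⊕-comm        = ⊕-comm
  mapT-derivation g ⊕-idem        = ⊕-idem
  mapT-derivation g ⊕-zero        = ⊕-zero
  mapT-derivation g ⊙-assoc       = ⊙-assoc
  mapT-derivation g ⊙-oneˡ        = ⊙-oneˡ
  mapT-derivation g ⊙-oneʳ        = ⊙-oneʳ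
  mapT-derivation g ⊙-zeroˡ       = ⊙-zeroˡ
  mapT-derivation g ⊙-zeroʳ       = ⊙-zeroʳ
  mapT-derivation g distribˡ      = distribˡ
  mapT-derivation g distribʳ      = distribʳ
  mapT-derivation g ⋆-unfold      = ⋆-unfold
  mapT-derivation g (⋆-indˡ d)    = ⋆-indˡ (mapT-derivation g d)
  mapT-derivation g (⋆-indʳ d)    = ⋆-indʳ (mapT-derivation g d)
  mapT-derivation g (hyp {e} {f} h) = g e f h

  mapT-⟦⟧ : ∀ {e w} → ⟦ e ⟧ w → ⟦ mapT ι e ⟧ (map ι w)
  mapT-⟦⟧ (inl x)                   = inl (mapT-⟦⟧ x)
  mapT-⟦⟧ (inr x)                   = inr (mapT-⟦⟧ x)
  mapT-⟦⟧ (cat {u = u} {v} x y eq)  = cat (mapT-⟦⟧ x) (mapT-⟦⟧ y) (Eq.trans (Eq.cong (map ι) eq) (map-++ ι u v))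
  mapT-⟦⟧ nil                       = nil
  mapT-⟦⟧ (more {u = u} {v} x y eq) = more (mapT-⟦⟧ x) (mapT-⟦⟧ y) (Eq.trans (Eq.cong (map ι) eq) (map-++ ι u v))
  mapT-⟦⟧ one                       = one
  mapT-⟦⟧ sym                       = sym

  mapT-⟦⟧⁻¹ : ∀ e {x} → ⟦ mapT ι e ⟧ x → ∃ λ w → x ≡ map ι w × ⟦ e ⟧ w
  mapT-⟦⟧⁻¹ (e ⊕ f) (inl m) = let (w , eq , m′) = mapT-⟦⟧⁻¹ e m in w , eq , inl m′
  mapT-⟦⟧⁻¹ (e ⊕ f) (inr m) = let (w , eq , m′) = mapT-⟦⟧⁻¹ f m in w , eq , inr m′
  mapT-⟦⟧⁻¹ (e ⊙ f) (cat m n eq) =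
    let (a , ea , ma) = mapT-⟦⟧⁻¹ e m ; (b , eb , mb) = mapT-⟦⟧⁻¹ f n in
    a ++ b , Eq.trans eq (Eq.trans (Eq.cong₂ _++_ ea eb) (Eq.sym (map-++ ι a b))) , cat ma mb Eq.refl
  mapT-⟦⟧⁻¹ (e ⋆) nil = [] , Eq.refl , nil
  mapT-⟦⟧⁻¹ (e ⋆) (more m n eq) =
    let (a , ea , ma) = mapT-⟦⟧⁻¹ e m ; (b , eb , mb) = mapT-⟦⟧⁻¹ (e ⋆) n in
    a ++ b , Eq.trans eq (Eq.trans (Eq.cong₂ _++_ ea eb) (Eq.sym (map-++ ι a b))) , more ma mb Eq.refl
  mapT-⟦⟧⁻¹ 𝟘 ()
  mapT-⟦⟧⁻¹ 𝟙 one     = [] , Eq.refl , one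
  mapT-⟦⟧⁻¹ (lit a) sym = _ , Eq.refl , sym

  mapT-Closure : ∀ {H H' e w} → H ⊢[ι] H' → Closure H' ⟦ e ⟧ w → Closure H ⟦ mapT ι e ⟧ (map ι w)
  mapT-Closure g (base x) = base (mapT-⟦⟧ x)
  mapT-Closure {H} {e = e₀} g (step {e} {f} h u v k {w₀} ew eq) =
    Eq.subst (Closure H ⟦ mapT ι e₀ ⟧) (Eq.sym (Eq.trans (Eq.cong (map ι) eq) (map-++₃ ι u w₀ v)))
      (Closure-bindInContext (map ι u) (map ι v) (sound-≤ H (g e f h) (mapT-⟦⟧ ew)) λ m →
        let (x , ex , mx) = mapT-⟦⟧⁻¹ f m in
        Eq.subst (Closure H ⟦ mapT ι e₀ ⟧)
          (Eq.trans (map-++₃ ι u x v) (Eq.cong (λ t → map ι u ++ t ++ map ι v) (Eq.sym ex)))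
          (mapT-Closure g (k x mx)))

module Reduction {Γ Σ : Set} {ι : Γ → Σ} {H : Hyps Σ} {H' : Hyps Γ} {r : T Σ → T Γ}
                 (reduction : Reduces ι H H' r) where

  open Reduces reduction

  reduct-≈⇒≈ : ∀ {e f} → H' ⊢ r e ≈ r f → H ⊢ e ≈ f
  reduct-≈⇒≈ {e} {f} d = trans (equiv e) (trans (mapT-derivation ι derivesH' d) (sym (equiv f)))

  ≈⇒reduct-Closure⊆ : ∀ {e f} → H ⊢ e ≈ f → ∀ {w} → Closure H' ⟦ r e ⟧ w → Closure H' ⟦ r f ⟧ w
  ≈⇒reduct-Closure⊆ {e} {f} d {w} c = closure⊆ f w
    (proj₁ (soundness H d _) (proj₂ (soundness H (equiv e) _) (mapT-Closure ι derivesH' c)))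

  ≈⇒reduct-≈ : KAComplete H' → ∀ {e f} → H ⊢ e ≈ f → H' ⊢ r e ≈ r f
  ≈⇒reduct-≈ complete {e} {f} d =
    complete (r e) (r f) λ w → ≈⇒reduct-Closure⊆ d , ≈⇒reduct-Closure⊆ (sym d)

theorem2p12 : {Γ Σ : Set} (ι : Γ → Σ) → Injective _≡_ _≡_ ι →
    (H : Hyps Σ) (H' : Hyps Γ) →
    KAComplete H' → KADecidable H' →
    (r : T Σ → T Γ) → Reduces ι H H' r →
    KADecidable H
theorem2p12 ι _ H H' complete decide r reduction e f =
  map′ reduct-≈⇒≈ (≈⇒reduct-≈ complete) (decide (r e) (r f))
  where open Reduction reduction
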